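{- If $q$ is a connected non-negative unit form of Dynkin type $\mathbb{E}_r$ for some $r\in\{6,7,8\}$, then $q$ is not the incidence form $q_{\mathbf{B}}$ of any bidirected graph $\mathbf{B}$.
   Context: A unit form is $q(x)=\sum_{i=1}^nx_i^2+\sum_{i<j}q_{ij}x_ix_j$ with $q_{ij}\in\mathbb{Z}$; connected if the graph $i\sim j$ iff $q_{ij}\ne0$ is connected; non-negative if $q(x)\ge0$. For a graph $D$ on $\{1,\dots,r\}$ let $q_D(x)=\sum x_i^2-\sum_{\text{edges }ij}x_ix_j$. A non-negative connected unit form of rank $r$ and corank $c$ is $\mathbb{Z}$-equivalent ($q\circ T$, $T\in GL(\mathbb{Z})$) to $q_{D_r}\oplus(\text{zero form in }c\text{ variables})$ for a unique Dynkin graph $D_r\in\{\mathbb{A}_r,\mathbb{D}_r,\mathbb{E}_6,\mathbb{E}_7,\mathbb{E}_8\}$, its Dynkin type. A bidirected graph $\mathbf{B}$ has vertices, arrows, and for each arrow $i$ a multiset $\{(u,\epsilon),(u',\epsilon')\}\subset V(\mathbf{B})\times\{\pm1\}$; $I(\mathbf{B})^Te_i=\epsilon e_u+\epsilon'e_{u'}$ and $q_{\mathbf{B}}(x)=\frac12x^TI(\mathbf{B})I(\mathbf{B})^Tx$. -}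

module Defs where

open import Data.Nat as ℕ using (ℕ; zero; suc; _≤_)
open import Data.Integer as ℤ using (ℤ; +_; _+_; _*_; -_; _-_)
open import Data.Fin as Fin using (Fin; zero; suc; toℕ; inject≤)
open import Data.Bool using (Bool; true; false; if_then_else_)
open import Data.Product using (Σ; _×_; _,_)
open import Data.Sum using (_⊎_)
open import Data.Sign using (Sign)
open import Relation.Binary.PropositionalEquality using (_≡_; _≢_)
open import Relation.Nullary using (does)

∑ : ∀ {n} → (Fin n → ℤ) → ℤ
∑ {zero}  f = + 0
∑ {suc n} f = f zero + ∑ (λ i → f (suc i))

[_<_]· : ∀ {n} → Fin n → Fin n → ℤ → ℤ
[ i < j ]· a = if does (toℕ i ℕ.<? toℕ j) then a else + 0

-- Unit forms:  q(x) = Σ x_i² + Σ_{i<j} q_ij x_i x_j.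
-- A unit form in n variables is given by its coefficients q_ij;
-- only the entries with i < j are used.

record UnitForm (n : ℕ) : Set where
  constructor unitForm
  field coef : Fin n → Fin n → ℤ
open UnitForm public

eval : ∀ {n} → UnitForm n → (Fin n → ℤ) → ℤ
eval q x = ∑ (λ i → x i * x i)
         + ∑ (λ i → ∑ (λ j → [ i < j ]· (coef q i j * x i * x j)))

Adj : ∀ {n} → UnitForm n → Fin n → Fin n → Set
Adj q i j = (toℕ i ℕ.< toℕ j × coef q i j ≢ + 0)
          ⊎ (toℕ j ℕ.< toℕ i × coef q j i ≢ + 0)

data Reach {n} (q : UnitForm n) (i : Fin n) : Fin n → Set where
  here : Reach q i i
  step : ∀ {j k} → Reach q i j → Adj q j k → Reach q i k

Connected : ∀ {n} → UnitForm n → Set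
Connected q = ∀ i j → Reach q i j

NonNegative : ∀ {n} → UnitForm n → Set
NonNegative q = ∀ x → + 0 ℤ.≤ eval q x

-- Graph forms q_D(x) = Σ x_i² - Σ_{edges ij} x_i x_j, for a graph D on
-- Fin r given by a decidable edge relation (only i < j is used).

GraphForm : ∀ {r} → (Fin r → Fin r → Bool) → UnitForm r
GraphForm edge = unitForm (λ i j → if edge i j then - + 1 else + 0)

-- The Dynkin graph E_r (r ∈ {6,7,8}), vertices 0..r-1:
-- a path 0 - 1 - ... - (r-2), and vertex r-1 attached to vertex 2.
-- Arms from the branch vertex 2 have lengths 2, r-4, 1.
Eedge : (r : ℕ) → Fin r → Fin r → Bool
Eedge r i j =
  (if toℕ j ℕ.≡ᵇ suc (toℕ i) then (toℕ j ℕ.<ᵇ r ℕ.∸ 1) else false)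
  Data.Bool.∨ (if toℕ i ℕ.≡ᵇ 2 then toℕ j ℕ.≡ᵇ (r ℕ.∸ 1) else false)
  where import Data.Bool

qE : (r : ℕ) → UnitForm r
qE r = GraphForm (Eedge r)

Mat : ℕ → Set
Mat n = Fin n → Fin n → ℤ

_·ᵥ_ : ∀ {n} → Mat n → (Fin n → ℤ) → (Fin n → ℤ)
(T ·ᵥ x) i = ∑ (λ j → T i j * x j)

_·ₘ_ : ∀ {n} → Mat n → Mat n → Mat n
(S ·ₘ T) i k = ∑ (λ j → S i j * T j k)

δ : ∀ {n} → Mat n
δ i j = if does (i Fin.≟ j) then + 1 else + 0

InGL : ∀ {n} → Mat n → Set
InGL T = Σ (Mat _) λ S → (∀ i j → (T ·ₘ S) i j ≡ δ i j)
                       × (∀ i j → (S ·ₘ T) i j ≡ δ i j)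

-- q is Z-equivalent to q_D ⊕ (zero form in n - r variables):
-- the first r coordinates carry q_D, the remaining ones the zero form.
HasDynkinType : ∀ {n r} → UnitForm r → UnitForm n → Set
HasDynkinType {n} {r} qD q =
  Σ (r ≤ n) λ r≤n → Σ (Mat n) λ T → InGL T ×
    (∀ x → eval q (T ·ᵥ x) ≡ eval qD (λ i → x (inject≤ i r≤n)))

sgn : Sign → ℤ
sgn Sign.+ = + 1
sgn Sign.- = - + 1

record Bidirected (m : ℕ) : Set where
  field
    nVert : ℕ
    end₁  : Fin m → Fin nVert × Sign
    end₂  : Fin m → Fin nVert × Sign
open Bidirected public

incidence : ∀ {m} (B : Bidirected m) → Fin m → Fin (nVert B) → ℤ
incidence B i v = part (end₁ B i) + part (end₂ B i)
  where
  part : Fin (nVert B) × Sign → ℤ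
  part (u , ε) = if does (u Fin.≟ v) then sgn ε else + 0

-- xᵀ I(B) I(B)ᵀ x  ( = 2 q_B(x) )
twiceIncForm : ∀ {m} (B : Bidirected m) → (Fin m → ℤ) → ℤ
twiceIncForm B x = ∑ (λ v → y v * y v)
  where y = λ v → ∑ (λ i → x i * incidence B i v)

IsIncidenceForm : ∀ {m} → UnitForm m → Bidirected m → Set
IsIncidenceForm q B = ∀ x → + 2 * eval q x ≡ twiceIncForm B x

module Submission where

-- If q = q_B and q ∘ T = q_{E_r} ⊕ 0, then x ↦ I(B)ᵀ T x doubles quadratic forms, so by
-- polarization it sends the simple roots of the E₆ inside E_r to integer vectors of norm 2
-- whose Gram matrix is the Cartan matrix of E₆. Integer vectors of norm 2 have entries in
-- {−1, 0, 1} and two-element supports, and x · y is congruent mod 2 to the number of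
-- coordinates the supports share. So the branch root meets each of its three pairwise
-- orthogonal neighbours in exactly one of its two coordinates, and two of the neighbours
-- get the same support. Vectors with the same support are congruent mod 2, so no vector
-- is adjacent to one and orthogonal to the other; but in E₆ each such pair is separated.

open import Data.Nat as ℕ using (ℕ; z≤n; s≤s)
import Data.Nat.Properties as ℕ
open import Data.Integer as ℤ
  using (ℤ; +_; -[1+_]; 0ℤ; 1ℤ; -1ℤ; _+_; _*_; _-_; _≤_; _≤?_; _≟_; +≤+)
import Data.Integer.Properties as ℤ
open import Data.Integer.Divisibility.Signed using (_∣_; _∣?_; divides; ∣m∣n⇒∣m+n; ∣n⇒∣m*n)
open import Data.Integer.Tactic.RingSolver using (solve-∀)
open import Data.Fin as Fin using (Fin; zero; suc; fromℕ; inject≤; _↑ˡ_; #_)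
open import Data.Fin.Properties using (all?; inject≤-injective)
open import Data.Vec.Functional using (zipWith)
open import Data.Product using (Σ; ∃-syntax; _,_)
open import Data.Sum using (_⊎_; inj₁; inj₂)
open import Data.Empty using (⊥; ⊥-elim)
open import Data.Bool using (if_then_else_)
open import Function using (_∘_; mk⇔)
open import Relation.Nullary using (¬_; Dec)
open import Relation.Nullary.Decidable using (True; toWitness; from-no; does-⇔; _→-dec_)
open import Relation.Binary.PropositionalEquality

open import Defs

∑-cong : ∀ {N} {f g : Fin N → ℤ} → (∀ i → f i ≡ g i) → ∑ f ≡ ∑ g
∑-cong {ℕ.zero}  f≗g = refl
∑-cong {ℕ.suc N} f≗g = cong₂ _+_ (f≗g zero) (∑-cong (f≗g ∘ suc))

∑-distrib-+ : ∀ {N} (f g : Fin N → ℤ) → ∑ (λ i → f i + g i) ≡ ∑ f + ∑ g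
∑-distrib-+ {ℕ.zero}  f g = refl
∑-distrib-+ {ℕ.suc N} f g = begin
  (f zero + g zero) + ∑ (λ i → f (suc i) + g (suc i))
    ≡⟨ cong (λ s → f zero + g zero + s) (∑-distrib-+ (f ∘ suc) (g ∘ suc)) ⟩
  (f zero + g zero) + (∑ (f ∘ suc) + ∑ (g ∘ suc))
    ≡⟨ interchange (f zero) (g zero) _ _ ⟩
  (f zero + ∑ (f ∘ suc)) + (g zero + ∑ (g ∘ suc))
    ∎
  where
  open ≡-Reasoning
  interchange : ∀ a b c d → (a + b) + (c + d) ≡ (a + c) + (b + d)
  interchange = solve-∀

∑-distrib-+₃ : ∀ {N} (f g h : Fin N → ℤ) → ∑ (λ i → f i + g i + h i) ≡ ∑ f + ∑ g + ∑ h
∑-distrib-+₃ f g h = trans (∑-distrib-+ _ h) (cong (_+ ∑ h) (∑-distrib-+ f g))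

∑-mono-≤ : ∀ {N} {f g : Fin N → ℤ} → (∀ i → f i ≤ g i) → ∑ f ≤ ∑ g
∑-mono-≤ {ℕ.zero}  f≤g = ℤ.≤-refl
∑-mono-≤ {ℕ.suc N} f≤g = ℤ.+-mono-≤ (f≤g zero) (∑-mono-≤ (f≤g ∘ suc))

∑-nonneg : ∀ {N} {f : Fin N → ℤ} → (∀ i → 0ℤ ≤ f i) → 0ℤ ≤ ∑ f
∑-nonneg {ℕ.zero}  f≥0 = ℤ.≤-refl
∑-nonneg {ℕ.suc N} f≥0 = ℤ.+-mono-≤ (f≥0 zero) (∑-nonneg (f≥0 ∘ suc))

≤-∑ : ∀ {N} {f : Fin N → ℤ} → (∀ i → 0ℤ ≤ f i) → ∀ i → f i ≤ ∑ f
≤-∑ {f = f} f≥0 zero    =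
  subst (_≤ ∑ f) (ℤ.+-identityʳ (f zero)) (ℤ.+-monoʳ-≤ (f zero) (∑-nonneg (f≥0 ∘ suc)))
≤-∑ {f = f} f≥0 (suc i) =
  subst (_≤ ∑ f) (ℤ.+-identityˡ (f (suc i))) (ℤ.+-mono-≤ (f≥0 zero) (≤-∑ (f≥0 ∘ suc) i))

∑-nonneg-≡0 : ∀ {N} {f : Fin N → ℤ} → (∀ i → 0ℤ ≤ f i) → ∑ f ≡ 0ℤ → ∀ i → f i ≡ 0ℤ
∑-nonneg-≡0 f≥0 ∑f≡0 i = ℤ.≤-antisym (subst (_ ≤_) ∑f≡0 (≤-∑ f≥0 i)) (f≥0 i)

infix 4 _≡₂_

_≡₂_ : ℤ → ℤ → Set
a ≡₂ b = + 2 ∣ a - b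

∑-cong-≡₂ : ∀ {N} {f g : Fin N → ℤ} → (∀ i → f i ≡₂ g i) → ∑ f ≡₂ ∑ g
∑-cong-≡₂ {ℕ.zero}          f≡₂g = divides 0ℤ refl
∑-cong-≡₂ {ℕ.suc N} {f} {g} f≡₂g =
  subst (+ 2 ∣_) (regroup (f zero) (g zero) _ _) (∣m∣n⇒∣m+n (f≡₂g zero) (∑-cong-≡₂ (f≡₂g ∘ suc)))
  where
  regroup : ∀ a b c d → (a - b) + (c - d) ≡ (a + c) - (b + d)
  regroup = solve-∀

0≤sq : ∀ a → 0ℤ ≤ a * a
0≤sq (+ ℕ.zero)  = +≤+ z≤n
0≤sq (+ ℕ.suc n) = +≤+ z≤n
0≤sq -[1+ n ]    = +≤+ z≤n

infix 7 _·_

_·_ : ∀ {N} → (Fin N → ℤ) → (Fin N → ℤ) → ℤ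
x · y = ∑ (λ i → x i * y i)

_² : ∀ {N} → (Fin N → ℤ) → Fin N → ℤ
(x ²) i = x i * x i

·-cong : ∀ {N} {x x′ y y′ : Fin N → ℤ} → (∀ i → x i ≡ x′ i) → (∀ i → y i ≡ y′ i) → x · y ≡ x′ · y′
·-cong x≗x′ y≗y′ = ∑-cong (λ i → cong₂ _*_ (x≗x′ i) (y≗y′ i))

·-distribˡ-+ : ∀ {N} (w x y : Fin N → ℤ) → w · zipWith _+_ x y ≡ w · x + w · y
·-distribˡ-+ w x y = trans (∑-cong (λ i → ℤ.*-distribˡ-+ (w i) (x i) (y i)))
  (∑-distrib-+ (λ i → w i * x i) (λ i → w i * y i))

·-distribʳ-+ : ∀ {N} (w x y : Fin N → ℤ) → zipWith _+_ x y · w ≡ x · w + y · w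
·-distribʳ-+ w x y = trans (∑-cong (λ i → ℤ.*-distribʳ-+ (w i) (x i) (y i)))
  (∑-distrib-+ (λ i → x i * w i) (λ i → y i * w i))

·-congˡ-≡₂ : ∀ {N} (w : Fin N → ℤ) {x y : Fin N → ℤ} → (∀ i → x i ≡₂ y i) → w · x ≡₂ w · y
·-congˡ-≡₂ w {x} {y} x≡₂y = ∑-cong-≡₂ λ i →
  subst (+ 2 ∣_) (factor (w i) (x i) (y i)) (∣n⇒∣m*n (w i) (x≡₂y i))
  where
  factor : ∀ a b c → a * (b - c) ≡ a * b - a * c
  factor = solve-∀

·-+-square : ∀ {N} (x y : Fin N → ℤ) →
             zipWith _+_ x y · zipWith _+_ x y ≡ x · x + y · y + (x · y + x · y)
·-+-square {N} x y = begin
  ∑ (λ i → (x i + y i) * (x i + y i))                      ≡⟨ ∑-cong (λ i → expand (x i) (y i)) ⟩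
  ∑ (λ i → x i * x i + y i * y i + (x i * y i + x i * y i)) ≡⟨ ∑-distrib-+₃ (x ²) (y ²) _ ⟩
  x · x + y · y + ∑ (λ i → x i * y i + x i * y i)          ≡⟨ cong (λ s → x · x + y · y + s) (∑-distrib-+ xy xy) ⟩
  x · x + y · y + (x · y + x · y)                          ∎
  where
  open ≡-Reasoning
  xy : Fin N → ℤ
  xy = zipWith _*_ x y
  expand : ∀ a b → (a + b) * (a + b) ≡ a * a + b * b + (a * b + a * b)
  expand = solve-∀

polarization : ∀ {m N} (φ : (Fin m → ℤ) → Fin N → ℤ) (Q : (Fin m → ℤ) → ℤ) →
               (∀ x y i → φ (zipWith _+_ x y) i ≡ φ x i + φ y i) →
               (∀ x → φ x · φ x ≡ + 2 * Q x) →
               ∀ x y → φ x · φ y ≡ Q (zipWith _+_ x y) - Q x - Q y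
polarization φ Q additive norm x y = halve (begin
  + 2 * Q (zipWith _+_ x y)                   ≡⟨ norm (zipWith _+_ x y) ⟨
  φ (zipWith _+_ x y) · φ (zipWith _+_ x y)  ≡⟨ ·-cong (additive x y) (additive x y) ⟩
  zipWith _+_ (φ x) (φ y) · zipWith _+_ (φ x) (φ y)
                                              ≡⟨ ·-+-square (φ x) (φ y) ⟩
  φ x · φ x + φ y · φ y + (d + d)             ≡⟨ cong₂ (λ a b → a + b + (d + d)) (norm x) (norm y) ⟩
  + 2 * Q x + + 2 * Q y + (d + d)             ∎)
  where
  open ≡-Reasoning
  d : ℤ
  d = φ x · φ y
  halve : ∀ {a b c} → + 2 * c ≡ + 2 * a + + 2 * b + (d + d) → d ≡ c - a - b
  halve {a} {b} {c} eq = ℤ.*-cancelˡ-≡ (+ 2) d (c - a - b) (begin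
    + 2 * d                                   ≡⟨ isolate a b d ⟩
    (+ 2 * a + + 2 * b + (d + d)) - + 2 * a - + 2 * b ≡⟨ cong (λ s → s - + 2 * a - + 2 * b) eq ⟨
    + 2 * c - + 2 * a - + 2 * b               ≡⟨ factor c a b ⟩
    + 2 * (c - a - b)                         ∎)
    where
    open ≡-Reasoning
    isolate : ∀ a b d → + 2 * d ≡ (+ 2 * a + + 2 * b + (d + d)) - + 2 * a - + 2 * b
    isolate = solve-∀
    factor : ∀ c a b → + 2 * c - + 2 * a - + 2 * b ≡ + 2 * (c - a - b)
    factor = solve-∀

trit : Fin 3 → ℤ
trit zero             = -1ℤ
trit (suc zero)       = 0ℤ
trit (suc (suc zero)) = 1ℤ

Ternary : ℤ → Set
Ternary a = ∃[ t ] trit t ≡ a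

sq≤2⇒ternary : ∀ a → a * a ≤ + 2 → Ternary a
sq≤2⇒ternary (+ 0)      _ = # 1 , refl
sq≤2⇒ternary (+ 1)      _ = # 2 , refl
sq≤2⇒ternary -[1+ 0 ]   _ = # 0 , refl
sq≤2⇒ternary (+ ℕ.suc (ℕ.suc n)) (+≤+ (s≤s (s≤s ≤0))) with () ← ℕ.m+n≤o⇒n≤o n ≤0
sq≤2⇒ternary -[1+ ℕ.suc n ]      (+≤+ (s≤s (s≤s ≤0))) with () ← ℕ.m+n≤o⇒n≤o n ≤0

module _ {P : ℤ → ℤ → Set} (P? : ∀ a b → Dec (P a b)) where

  ternary-cases₂ : {True (all? λ s → all? λ t → P? (trit s) (trit t))} →
                   ∀ {a b} → Ternary a → Ternary b → P a b
  ternary-cases₂ {holds} (s , refl) (t , refl) = toWitness holds s t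

module _ {P : ℤ → ℤ → ℤ → ℤ → Set} (P? : ∀ a b c d → Dec (P a b c d)) where

  ternary-cases₄ : {True (all? λ s → all? λ t → all? λ u → all? λ v →
                           P? (trit s) (trit t) (trit u) (trit v))} →
                   ∀ {a b c d} → Ternary a → Ternary b → Ternary c → Ternary d → P a b c d
  ternary-cases₄ {holds} (s , refl) (t , refl) (u , refl) (v , refl) = toWitness holds s t u v

module _ {a b : ℤ} where

  sq*sq≡₂* : Ternary a → Ternary b → a * a * (b * b) ≡₂ a * b
  sq*sq≡₂* = ternary-cases₂ (λ a b → + 2 ∣? a * a * (b * b) - a * b)

  0≤sq*sq : Ternary a → Ternary b → 0ℤ ≤ a * a * (b * b)
  0≤sq*sq = ternary-cases₂ (λ a b → 0ℤ ≤? a * a * (b * b))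

  sq*sq≤sq : Ternary a → Ternary b → a * a * (b * b) ≤ a * a
  sq*sq≤sq = ternary-cases₂ (λ a b → a * a * (b * b) ≤? a * a)

  sq-difference : Ternary a → Ternary b →
                  (a * a - b * b) * (a * a - b * b) + (a * a * (b * b) + a * a * (b * b)) ≡ a * a + b * b
  sq-difference = ternary-cases₂ (λ a b →
    (a * a - b * b) * (a * a - b * b) + (a * a * (b * b) + a * a * (b * b)) ≟ a * a + b * b)

  equal-sq⇒≡₂ : Ternary a → Ternary b → (a * a - b * b) * (a * a - b * b) ≡ 0ℤ → a ≡₂ b
  equal-sq⇒≡₂ = ternary-cases₂ (λ a b → ((a * a - b * b) * (a * a - b * b) ≟ 0ℤ) →-dec (+ 2 ∣? a - b))

sq-inclusion-exclusion : ∀ {c a b d} → Ternary c → Ternary a → Ternary b → Ternary d →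
  c * c * (a * a) + c * c * (b * b) + c * c * (d * d)
    ≤ a * a * (b * b) + a * a * (d * d) + b * b * (d * d) + c * c
sq-inclusion-exclusion = ternary-cases₄ (λ c a b d →
  c * c * (a * a) + c * c * (b * b) + c * c * (d * d)
    ≤? a * a * (b * b) + a * a * (d * d) + b * b * (d * d) + c * c)

odd-in-[0,2] : ∀ {s} → 0ℤ ≤ s → s ≤ + 2 → s ≡₂ -1ℤ → s ≡ 1ℤ
odd-in-[0,2] {+ 0} _ _ 2∣1 = ⊥-elim (from-no (+ 2 ∣? 1ℤ) 2∣1)
odd-in-[0,2] {+ 1} _ _ _   = refl
odd-in-[0,2] {+ 2} _ _ 2∣3 = ⊥-elim (from-no (+ 2 ∣? + 3) 2∣3)
odd-in-[0,2] {+ ℕ.suc (ℕ.suc (ℕ.suc _))} _ (+≤+ (s≤s (s≤s ())))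
odd-in-[0,2] { -[1+ _ ]} ()

even-in-[0,2] : ∀ {s} → 0ℤ ≤ s → s ≤ + 2 → s ≡₂ 0ℤ → s ≡ 0ℤ ⊎ s ≡ + 2
even-in-[0,2] {+ 0} _ _ _   = inj₁ refl
even-in-[0,2] {+ 1} _ _ 2∣1 = ⊥-elim (from-no (+ 2 ∣? 1ℤ) 2∣1)
even-in-[0,2] {+ 2} _ _ _   = inj₂ refl
even-in-[0,2] {+ ℕ.suc (ℕ.suc (ℕ.suc _))} _ (+≤+ (s≤s (s≤s ())))
even-in-[0,2] { -[1+ _ ]} ()

record Root {N} (x : Fin N → ℤ) : Set where
  constructor root
  field norm≡2 : x · x ≡ + 2
open Root

-- For roots, x ² is the indicator vector of the support, so x ² · y ² counts the shared coordinates.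
SameSupport : ∀ {N} → (Fin N → ℤ) → (Fin N → ℤ) → Set
SameSupport x y = x ² · y ² ≡ + 2

root-ternary : ∀ {N} {x : Fin N → ℤ} → Root x → ∀ i → Ternary (x i)
root-ternary {x = x} x-root i =
  sq≤2⇒ternary (x i) (subst (x i * x i ≤_) (norm≡2 x-root) (≤-∑ (λ j → 0≤sq (x j)) i))

module _ {N} {x y : Fin N → ℤ} (x-root : Root x) (y-root : Root y) where

  private
    tx : ∀ i → Ternary (x i)
    tx = root-ternary x-root
    ty : ∀ i → Ternary (y i)
    ty = root-ternary y-root

  overlap-nonneg : 0ℤ ≤ x ² · y ²
  overlap-nonneg = ∑-nonneg (λ i → 0≤sq*sq (tx i) (ty i))

  overlap≤2 : x ² · y ² ≤ + 2
  overlap≤2 = subst (x ² · y ² ≤_) (norm≡2 x-root) (∑-mono-≤ (λ i → sq*sq≤sq (tx i) (ty i)))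

  overlap≡₂· : x ² · y ² ≡₂ x · y
  overlap≡₂· = ∑-cong-≡₂ (λ i → sq*sq≡₂* (tx i) (ty i))

  overlap-adjacent : x · y ≡ -1ℤ → x ² · y ² ≡ 1ℤ
  overlap-adjacent x·y≡-1 =
    odd-in-[0,2] overlap-nonneg overlap≤2 (subst (x ² · y ² ≡₂_) x·y≡-1 overlap≡₂·)

  overlap-orthogonal : x · y ≡ 0ℤ → x ² · y ² ≡ 0ℤ ⊎ SameSupport x y
  overlap-orthogonal x·y≡0 =
    even-in-[0,2] overlap-nonneg overlap≤2 (subst (x ² · y ² ≡₂_) x·y≡0 overlap≡₂·)

  private
    Δ common : Fin N → ℤ
    Δ      = zipWith _-_ (x ²) (y ²)
    common = zipWith _*_ (x ²) (y ²)

  Δ·Δ+2overlap : Δ · Δ + (x ² · y ² + x ² · y ²) ≡ x · x + y · y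
  Δ·Δ+2overlap = begin
    Δ · Δ + (x ² · y ² + x ² · y ²)              ≡⟨ cong (λ s → Δ · Δ + s) (∑-distrib-+ common common) ⟨
    Δ · Δ + ∑ (λ i → common i + common i)        ≡⟨ ∑-distrib-+ (λ i → Δ i * Δ i) (λ i → common i + common i) ⟨
    ∑ (λ i → Δ i * Δ i + (common i + common i))  ≡⟨ ∑-cong (λ i → sq-difference (tx i) (ty i)) ⟩
    ∑ (λ i → x i * x i + y i * y i)              ≡⟨ ∑-distrib-+ (x ²) (y ²) ⟩
    x · x + y · y                                ∎
    where open ≡-Reasoning

  same-support⇒≡₂ : SameSupport x y → ∀ i → x i ≡₂ y i
  same-support⇒≡₂ x~y i = equal-sq⇒≡₂ (tx i) (ty i) (∑-nonneg-≡0 (λ j → 0≤sq (Δ j)) Δ·Δ≡0 i)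
    where
    Δ·Δ≡0 : Δ · Δ ≡ 0ℤ
    Δ·Δ≡0 = begin
      Δ · Δ                                  ≡⟨ shift (Δ · Δ) ⟩
      Δ · Δ + (+ 2 + + 2) - + 4              ≡⟨ cong (λ s → Δ · Δ + (s + s) - + 4) x~y ⟨
      Δ · Δ + (x ² · y ² + x ² · y ²) - + 4  ≡⟨ cong (λ s → s - + 4) Δ·Δ+2overlap ⟩
      x · x + y · y - + 4                    ≡⟨ cong₂ (λ a b → a + b - + 4) (norm≡2 x-root) (norm≡2 y-root) ⟩
      0ℤ                                     ∎
      where
      open ≡-Reasoning
      shift : ∀ s → s ≡ s + (+ 2 + + 2) - + 4
      shift = solve-∀

overlap-inclusion-exclusion : ∀ {N} {c a b d : Fin N → ℤ} → Root c → Root a → Root b → Root d →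
  c ² · a ² + c ² · b ² + c ² · d ² ≤ a ² · b ² + a ² · d ² + b ² · d ² + c · c
overlap-inclusion-exclusion {N} {c} {a} {b} {d} rc ra rb rd = begin
  c ² · a ² + c ² · b ² + c ² · d ²               ≡⟨ ∑-distrib-+₃ (ov c a) (ov c b) (ov c d) ⟨
  ∑ (λ i → ov c a i + ov c b i + ov c d i)        ≤⟨ ∑-mono-≤ (λ i → sq-inclusion-exclusion (root-ternary rc i)
                                                       (root-ternary ra i) (root-ternary rb i) (root-ternary rd i)) ⟩
  ∑ (λ i → ov a b i + ov a d i + ov b d i + c i * c i)
                                                  ≡⟨ ∑-distrib-+ (λ i → ov a b i + ov a d i + ov b d i) (c ²) ⟩
  ∑ (λ i → ov a b i + ov a d i + ov b d i) + c · c ≡⟨ cong (_+ c · c) (∑-distrib-+₃ (ov a b) (ov a d) (ov b d)) ⟩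
  a ² · b ² + a ² · d ² + b ² · d ² + c · c       ∎
  where
  open ℤ.≤-Reasoning
  ov : (Fin N → ℤ) → (Fin N → ℤ) → Fin N → ℤ
  ov x y = zipWith _*_ (x ²) (y ²)

three-orthogonal-neighbours : ∀ {N} {c a b d : Fin N → ℤ} → Root c → Root a → Root b → Root d →
  c · a ≡ -1ℤ → c · b ≡ -1ℤ → c · d ≡ -1ℤ → a · b ≡ 0ℤ → a · d ≡ 0ℤ → b · d ≡ 0ℤ →
  SameSupport a b ⊎ SameSupport a d ⊎ SameSupport b d
three-orthogonal-neighbours {c = c} {a} {b} {d} rc ra rb rd ca cb cd ab ad bd
  with overlap-orthogonal ra rb ab | overlap-orthogonal ra rd ad | overlap-orthogonal rb rd bd
... | inj₂ a~b   | _         | _         = inj₁ a~b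
... | _         | inj₂ a~d  | _         = inj₂ (inj₁ a~d)
... | _         | _         | inj₂ b~d  = inj₂ (inj₂ b~d)
... | inj₁ ab≡0 | inj₁ ad≡0 | inj₁ bd≡0 = ⊥-elim (3≰2 (begin
  + 3                                         ≡⟨ cong₂ _+_ (cong₂ _+_ (overlap-adjacent rc ra ca) (overlap-adjacent rc rb cb))
                                                            (overlap-adjacent rc rd cd) ⟨
  c ² · a ² + c ² · b ² + c ² · d ²           ≤⟨ overlap-inclusion-exclusion rc ra rb rd ⟩
  a ² · b ² + a ² · d ² + b ² · d ² + c · c   ≡⟨ cong₂ _+_ (cong₂ _+_ (cong₂ _+_ ab≡0 ad≡0) bd≡0) (norm≡2 rc) ⟩
  + 2                                         ∎))
  where
  open ℤ.≤-Reasoning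
  3≰2 : ¬ (+ 3 ≤ + 2)
  3≰2 (+≤+ (s≤s (s≤s ())))

same-support-inseparable : ∀ {N} {x y : Fin N → ℤ} → Root x → Root y → SameSupport x y →
                             ∀ w → w · x ≡ -1ℤ → w · y ≡ 0ℤ → ⊥
same-support-inseparable rx ry x~y w w·x≡-1 w·y≡0 =
  from-no (+ 2 ∣? -1ℤ) (subst₂ _≡₂_ w·x≡-1 w·y≡0 (·-congˡ-≡₂ w (same-support⇒≡₂ rx ry x~y)))

polar : ∀ {r} → UnitForm r → Fin r → Fin r → ℤ
polar q k l = eval q (zipWith _+_ (δ k) (δ l)) - eval q (δ k) - eval q (δ l)

Realizes : ∀ {r N} → UnitForm r → (Fin r → Fin N → ℤ) → Set
Realizes q f = ∀ k l → f k · f l ≡ polar q k l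

E₆-unrealizable : ∀ {N} (f : Fin 6 → Fin N → ℤ) → ¬ Realizes (qE 6) f
-- 2 is the branch vertex with neighbours 1, 3, 5; vertex 0 separates 1 from 3 and 5, vertex 4 separates 3 from 5.
E₆-unrealizable f gram = no-shared-support
  (three-orthogonal-neighbours r₂ r₁ r₃ r₅ (gram _ _) (gram _ _) (gram _ _) (gram _ _) (gram _ _) (gram _ _))
  where
  r₁ : Root (f (# 1))
  r₁ = root (gram _ _)
  r₂ : Root (f (# 2))
  r₂ = root (gram _ _)
  r₃ : Root (f (# 3))
  r₃ = root (gram _ _)
  r₅ : Root (f (# 5))
  r₅ = root (gram _ _)
  no-shared-support : ¬ (SameSupport (f (# 1)) (f (# 3)) ⊎ SameSupport (f (# 1)) (f (# 5))
                                                         ⊎ SameSupport (f (# 3)) (f (# 5)))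
  no-shared-support (inj₁ f₁~f₃)        = same-support-inseparable r₁ r₃ f₁~f₃ (f (# 0)) (gram _ _) (gram _ _)
  no-shared-support (inj₂ (inj₁ f₁~f₅)) = same-support-inseparable r₁ r₅ f₁~f₅ (f (# 0)) (gram _ _) (gram _ _)
  no-shared-support (inj₂ (inj₂ f₃~f₅)) = same-support-inseparable r₃ r₅ f₃~f₅ (f (# 4)) (gram _ _) (gram _ _)

eval-cong : ∀ {r} (q : UnitForm r) {x y : Fin r → ℤ} → (∀ i → x i ≡ y i) → eval q x ≡ eval q y
eval-cong q x≗y = cong₂ _+_ (·-cong x≗y x≗y)
  (∑-cong λ i → ∑-cong λ j → cong₂ (λ a b → [ i < j ]· (coef q i j * a * b)) (x≗y i) (x≗y j))

δ-inject≤ : ∀ {r n} (r≤n : r ℕ.≤ n) (k i : Fin r) → δ (inject≤ k r≤n) (inject≤ i r≤n) ≡ δ k i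
δ-inject≤ r≤n k i = cong (λ b → if b then + 1 else + 0)
  (does-⇔ (mk⇔ (inject≤-injective r≤n r≤n k i) (cong (λ j → inject≤ j r≤n)))
           (inject≤ k r≤n Fin.≟ inject≤ i r≤n) (k Fin.≟ i))

incidence-realization : ∀ {n r} {qD : UnitForm r} {q : UnitForm n} (B : Bidirected n) →
                        HasDynkinType qD q → IsIncidenceForm q B →
                        Σ (Fin r → Fin (nVert B) → ℤ) (Realizes qD)
incidence-realization {n} {r} {qD} B (r≤n , T , _ , q∘T≡qD) q≡qB = φ ∘ e , gram
  where
  φ : (Fin n → ℤ) → Fin (nVert B) → ℤ
  φ x v = (T ·ᵥ x) · (λ i → incidence B i v)

  Q : (Fin n → ℤ) → ℤ
  Q x = eval qD (λ i → x (inject≤ i r≤n))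

  φ-additive : ∀ x y v → φ (zipWith _+_ x y) v ≡ φ x v + φ y v
  φ-additive x y v = trans (·-cong (λ i → ·-distribˡ-+ (T i) x y) (λ _ → refl))
                           (·-distribʳ-+ (λ i → incidence B i v) (T ·ᵥ x) (T ·ᵥ y))

  φ-norm : ∀ x → φ x · φ x ≡ + 2 * Q x
  φ-norm x = trans (sym (q≡qB (T ·ᵥ x))) (cong (+ 2 *_) (q∘T≡qD x))

  e : Fin r → Fin n → ℤ
  e k = δ (inject≤ k r≤n)

  gram : Realizes qD (φ ∘ e)
  gram k l = trans (polarization φ Q φ-additive φ-norm (e k) (e l))
    (cong₂ _-_ (cong₂ _-_ (eval-cong qD (λ i → cong₂ _+_ (δ-inject≤ r≤n k i) (δ-inject≤ r≤n l i)))
                          (eval-cong qD (δ-inject≤ r≤n k)))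
               (eval-cong qD (δ-inject≤ r≤n l)))

all-pairs-≡ : ∀ {n} {f g : Fin n → Fin n → ℤ} →
              {holds : True (all? λ k → all? λ l → f k l ≟ g k l)} → ∀ k l → f k l ≡ g k l
all-pairs-≡ {holds = holds} = toWitness holds

-- E₆ is the subdiagram of E_r on the vertices 0, …, 4 and r − 1.
E₆↪E : ∀ m → Fin 6 → Fin (6 ℕ.+ m)
E₆↪E m (suc (suc (suc (suc (suc zero))))) = fromℕ (5 ℕ.+ m)
E₆↪E m k                                   = k ↑ˡ m

E₆⊆E : ∀ {r} → 6 ℕ.≤ r → r ℕ.≤ 8 →
       Σ (Fin 6 → Fin r) λ ι → ∀ k l → polar (qE r) (ι k) (ι l) ≡ polar (qE 6) k l
E₆⊆E 6≤r r≤8 with ℕ.m≤n⇒∃[o]m+o≡n 6≤r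
... | 0 , refl = E₆↪E 0 , all-pairs-≡
... | 1 , refl = E₆↪E 1 , all-pairs-≡
... | 2 , refl = E₆↪E 2 , all-pairs-≡
... | ℕ.suc (ℕ.suc (ℕ.suc m)) , refl with s≤s (s≤s ()) ← ℕ.+-cancelˡ-≤ 6 (3 ℕ.+ m) 2 r≤8

corollary4p7 : ∀ {n} (q : UnitForm n) → Connected q → NonNegative q →
               (r : ℕ) → 6 ℕ.≤ r → r ℕ.≤ 8 → HasDynkinType (qE r) q →
               (B : Bidirected n) → ¬ IsIncidenceForm q B
corollary4p7 q _ _ r 6≤r r≤8 q~E B q≡qB =
  let f , f-realizes-E = incidence-realization {qD = qE r} {q} B q~E q≡qB
      ι , ι-preserves  = E₆⊆E 6≤r r≤8
  in  E₆-unrealizable (f ∘ ι) (λ k l → trans (f-realizes-E (ι k) (ι l)) (ι-preserves k l))
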